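{- Let $\mathscr{A}=\{m\cdot * + n\cdot *2 : m,n\in\mathbb{N}\}$. Let $G = m\cdot * + n\cdot *2$ and $H = m'\cdot * + n'\cdot *2$ with $n,n'\geq 1$, $m\equiv m' \pmod 2$ and $n\equiv n'\pmod 2$. Then $G\equiv_\mathscr{A} H$.
   Context: Games are finite, loopfree impartial games identified with their sets of options: $0=\{\}$, $*=\{0\}$, $*2=\{0,*\}$. Disjunctive sum: $G+H=\{G'+H\}\cup\{G+H'\}$ over options; $k\cdot G$ denotes the sum of $k$ copies of $G$. Mis\`ere outcome: $o^-(G)=\mathscr{P}$ iff $G\neq 0$ and every option $G'$ of $G$ has $o^-(G')=\mathscr{N}$; otherwise $\mathscr{N}$. For a set $\mathscr{A}$ of games closed under addition and $G,H\in\mathscr{A}$: $G\equiv_\mathscr{A} H$ iff $o^-(G+X)=o^-(H+X)$ for all $X\in\mathscr{A}$. -}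

module Defs where

open import Data.Nat using (ℕ; zero; suc) renaming (_+_ to _+ℕ_)
open import Data.Fin using (Fin; splitAt)
open import Data.Sum using (inj₁; inj₂; [_,_])
open import Data.Bool using (Bool; true; false; not)
open import Data.List using (allFin)
open import Data.Bool.ListAction using (all)
open import Relation.Binary.PropositionalEquality using (_≡_)

data Game : Set where
  node : (k : ℕ) → (Fin k → Game) → Game

𝟘 : Game
𝟘 = node 0 (λ ())

⋆ : Game
⋆ = node 1 (λ _ → 𝟘)

⋆2 : Game
⋆2 = node 2 opt
  where
  opt : Fin 2 → Game
  opt Fin.zero = 𝟘
  opt (Fin.suc _) = ⋆

-- Disjunctive sum: G + H = {G' + H} ∪ {G + H'}
infixl 6 _⊕_
_⊕_ : Game → Game → Game
node k f ⊕ node l g =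
  node (k +ℕ l) (λ i → [ (λ a → f a ⊕ node l g) , (λ b → node k f ⊕ g b) ] (splitAt k i))

infixr 7 _·_
_·_ : ℕ → Game → Game
zero · G = 𝟘
suc k · G = G ⊕ (k · G)

data Outcome : Set where
  𝒫 𝒩 : Outcome

isP : Game → Bool
isP (node zero f) = false
isP (node (suc k) f) = all (λ i → not (isP (f i))) (allFin (suc k))

o⁻ : Game → Outcome
o⁻ G with isP G
... | true = 𝒫
... | false = 𝒩

elemA : ℕ → ℕ → Game
elemA m n = (m · ⋆) ⊕ (n · ⋆2)

_≡𝒜_ : Game → Game → Set
G ≡𝒜 H = ∀ (a b : ℕ) → o⁻ (G ⊕ elemA a b) ≡ o⁻ (H ⊕ elemA a b)

{-# OPTIONS --safe #-}
module Submission where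

-- Read m · ⋆ ⊕ n · ⋆2 as the pair (m , n), with the three moves ⋆ ↦ 0, ⋆2 ↦ 0 and ⋆2 ↦ ⋆.
-- A game whose option tree is bisimilar to this move graph from (m , n) has the misère
-- outcome of any labelling of the pairs that satisfies the P/N recursion, and bisimilarity
-- is compatible with disjunctive sum. On pairs, a position with n ≥ 1 is a misère
-- P-position iff m and n are both even (the ⋆2 heaps make it behave as in normal play), so
-- the outcome of G ⊕ X for G, X ∈ 𝒜 only depends on parities, and adding X keeps n ≥ 1.

open import Defs
open import Data.Bool using (Bool; true; false; not; _∧_; T)
open import Data.Bool.Properties using (T-≡; T-not-≡; ¬-not; not-involutive)
open import Data.Empty using (⊥-elim)
open import Data.Fin using (Fin; splitAt; _↑ˡ_; _↑ʳ_) renaming (zero to fzero; suc to fsuc)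
open import Data.Fin.Properties using (splitAt-↑ˡ; splitAt-↑ʳ)
open import Data.List using (allFin)
open import Data.List.Membership.Propositional.Properties using (∈-allFin)
open import Data.List.Relation.Unary.All as All using ()
open import Data.List.Relation.Unary.All.Properties using (all⁺; all⁻)
open import Data.Nat using (ℕ; zero; suc; _+_; _≤_; _%_; s≤s; z≤n)
open import Data.Nat.DivMod using (%-distribˡ-+)
open import Data.Nat.Properties using (+-suc; +-identityʳ; m≤n⇒m≤n+o)
open import Data.Product using (_×_; _,_; proj₁; proj₂; ∃-syntax)
open import Data.Sum using (_⊎_; inj₁; inj₂; [_,_])
open import Function using (_∘_; Equivalence)
open import Relation.Nullary using (¬_)
open import Relation.Binary.PropositionalEquality
  using (_≡_; refl; sym; trans; cong; cong₂; subst; module ≡-Reasoning)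

open Equivalence using (to; from)

isP-node-true : ∀ {k f} → Fin k → (∀ i → isP (f i) ≡ false) → isP (node k f) ≡ true
isP-node-true {suc k} _ allN =
  T-≡ .to (all⁻ _ (All.tabulate {xs = allFin (suc k)} λ {i} _ → T-not-≡ .from (allN i)))

isP-node-false : ∀ {k f} i → isP (f i) ≡ true → isP (node k f) ≡ false
isP-node-false {suc k} {f} i fi-P = ¬-not λ node-P →
  subst (T ∘ not) fi-P (All.lookup (all⁺ _ _ (T-≡ .from node-P)) (∈-allFin i))

module Bisimulation {S : Set} (_⟶_ : S → S → Set) where

  infix 4 _∼_

  data _∼_ : Game → S → Set where
    bisim : ∀ {k f s} →
      (∀ i → ∃[ s' ] (s ⟶ s' × f i ∼ s')) →
      (∀ {s'} → s ⟶ s' → ∃[ i ] f i ∼ s') →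
      node k f ∼ s

  Terminal : S → Set
  Terminal s = ∀ {s'} → ¬ s ⟶ s'

  isP-∼-terminal : ∀ {G s} → Terminal s → G ∼ s → isP G ≡ false
  isP-∼-terminal {node zero f} _ _ = refl
  isP-∼-terminal {node (suc k) f} end (bisim sound _) =
    ⊥-elim (end (proj₁ (proj₂ (sound fzero))))

  record IsMisereLabelling (isPₛ : S → Bool) : Set where
    field
      P⇒nonterminal : ∀ {s} → isPₛ s ≡ true → ∃[ s' ] s ⟶ s'
      P⇒movesToN    : ∀ {s s'} → isPₛ s ≡ true → s ⟶ s' → isPₛ s' ≡ false
      N⇒terminal⊎movesToP : ∀ {s} → isPₛ s ≡ false →
        Terminal s ⊎ ∃[ s' ] (s ⟶ s' × isPₛ s' ≡ true)

  module _ {isPₛ : S → Bool} (labelling : IsMisereLabelling isPₛ) where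
    open IsMisereLabelling labelling

    isP-∼ : ∀ {G s} → G ∼ s → isP G ≡ isPₛ s
    isP-∼ {node k f} {s} G∼s@(bisim sound complete) with isPₛ s in s-P
    ... | true = isP-node-true (proj₁ (complete (proj₂ (P⇒nonterminal s-P)))) λ i →
      let (s' , s⟶s' , fi∼s') = sound i in trans (isP-∼ fi∼s') (P⇒movesToN s-P s⟶s')
    ... | false with N⇒terminal⊎movesToP s-P
    ...   | inj₁ end = isP-∼-terminal end G∼s
    ...   | inj₂ (s' , s⟶s' , s'-P) =
      let (i , fi∼s') = complete s⟶s' in isP-node-false i (trans (isP-∼ fi∼s') s'-P)

  module Additive (_⊕ₛ_ : S → S → S)
    (⟶-⊕ʳ : ∀ {s s'} t → s ⟶ s' → (s ⊕ₛ t) ⟶ (s' ⊕ₛ t))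
    (⟶-⊕ˡ : ∀ s {t t'} → t ⟶ t' → (s ⊕ₛ t) ⟶ (s ⊕ₛ t'))
    (⟶-⊕-inv : ∀ s t {u} → (s ⊕ₛ t) ⟶ u →
      (∃[ s' ] (s ⟶ s' × u ≡ s' ⊕ₛ t)) ⊎ (∃[ t' ] (t ⟶ t' × u ≡ s ⊕ₛ t')))
    where

    ∼-⊕-step : ∀ {k f l g s t} → node k f ∼ s → node l g ∼ t →
      (∀ a {s'} → f a ∼ s' → f a ⊕ node l g ∼ s' ⊕ₛ t) →
      (∀ b {t'} → g b ∼ t' → node k f ⊕ g b ∼ s ⊕ₛ t') →
      node k f ⊕ node l g ∼ s ⊕ₛ t
    ∼-⊕-step {k} {f} {l} {g} {s} {t}
      (bisim soundG completeG) (bisim soundH completeH) ∼-⊕ˡ ∼-⊕ʳ =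
      bisim (sound ∘ splitAt k) (complete ∘ ⟶-⊕-inv s t)
      where
      option : Fin k ⊎ Fin l → Game
      option = [ (λ a → f a ⊕ node l g) , (λ b → node k f ⊕ g b) ]

      sound : ∀ j → ∃[ u ] ((s ⊕ₛ t) ⟶ u × option j ∼ u)
      sound (inj₁ a) = let (s' , s⟶s' , fa∼s') = soundG a
                       in s' ⊕ₛ t , ⟶-⊕ʳ t s⟶s' , ∼-⊕ˡ a fa∼s'
      sound (inj₂ b) = let (t' , t⟶t' , gb∼t') = soundH b
                       in s ⊕ₛ t' , ⟶-⊕ˡ s t⟶t' , ∼-⊕ʳ b gb∼t'

      complete : ∀ {u} → (∃[ s' ] (s ⟶ s' × u ≡ s' ⊕ₛ t)) ⊎ (∃[ t' ] (t ⟶ t' × u ≡ s ⊕ₛ t')) →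
        ∃[ i ] option (splitAt k i) ∼ u
      complete (inj₁ (s' , s⟶s' , refl)) =
        let (a , fa∼s') = completeG s⟶s'
        in a ↑ˡ l , subst (λ j → option j ∼ _) (sym (splitAt-↑ˡ k a l)) (∼-⊕ˡ a fa∼s')
      complete (inj₂ (t' , t⟶t' , refl)) =
        let (b , gb∼t') = completeH t⟶t'
        in k ↑ʳ b , subst (λ j → option j ∼ _) (sym (splitAt-↑ʳ k l b)) (∼-⊕ʳ b gb∼t')

    ∼-⊕ : ∀ {G H s t} → G ∼ s → H ∼ t → G ⊕ H ∼ s ⊕ₛ t
    ∼-⊕ {node k f} {node l g} G∼s H∼t =
      ∼-⊕-step G∼s H∼t (λ a fa∼s' → ∼-⊕ fa∼s' H∼t) (λ b gb∼t' → ∼-⊕ G∼s gb∼t')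

even : ℕ → Bool
even zero    = true
even (suc n) = not (even n)

even-%2 : ∀ n → even (n % 2) ≡ even n
even-%2 zero          = refl
even-%2 (suc zero)    = refl
even-%2 (suc (suc n)) = trans (even-%2 n) (sym (not-involutive (even n)))

even-cong-%2 : ∀ m n → m % 2 ≡ n % 2 → even m ≡ even n
even-cong-%2 m n m≡n = trans (sym (even-%2 m)) (trans (cong even m≡n) (even-%2 n))

%2-cong-+ʳ : ∀ m n a → m % 2 ≡ n % 2 → (m + a) % 2 ≡ (n + a) % 2
%2-cong-+ʳ m n a m≡n = trans (%-distribˡ-+ m a 2)
  (trans (cong (λ r → (r + a % 2) % 2) m≡n) (sym (%-distribˡ-+ n a 2)))

Pos : Set
Pos = ℕ × ℕ

infixl 6 _⊕ᴾ_
_⊕ᴾ_ : Pos → Pos → Pos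
(m , n) ⊕ᴾ (m' , n') = (m + m' , n + n')

infix 4 _⟶_
data _⟶_ : Pos → Pos → Set where
  ⋆↦0  : ∀ {m n} → (suc m , n) ⟶ (m , n)
  ⋆2↦0 : ∀ {m n} → (m , suc n) ⟶ (m , n)
  ⋆2↦⋆ : ∀ {m n} → (m , suc n) ⟶ (suc m , n)

open Bisimulation _⟶_

⟶-⊕ᴾʳ : ∀ {s s'} t → s ⟶ s' → s ⊕ᴾ t ⟶ s' ⊕ᴾ t
⟶-⊕ᴾʳ _ ⋆↦0  = ⋆↦0
⟶-⊕ᴾʳ _ ⋆2↦0 = ⋆2↦0
⟶-⊕ᴾʳ _ ⋆2↦⋆ = ⋆2↦⋆

⟶-⊕ᴾˡ : ∀ s {t t'} → t ⟶ t' → s ⊕ᴾ t ⟶ s ⊕ᴾ t'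
⟶-⊕ᴾˡ (m , n) (⋆↦0 {m'}) rewrite +-suc m m' = ⋆↦0
⟶-⊕ᴾˡ (m , n) (⋆2↦0 {n = n'}) rewrite +-suc n n' = ⋆2↦0
⟶-⊕ᴾˡ (m , n) (⋆2↦⋆ {m'} {n'}) rewrite +-suc m m' | +-suc n n' = ⋆2↦⋆

⟶-⊕ᴾ-inv : ∀ s t {u} → s ⊕ᴾ t ⟶ u →
  (∃[ s' ] (s ⟶ s' × u ≡ s' ⊕ᴾ t)) ⊎ (∃[ t' ] (t ⟶ t' × u ≡ s ⊕ᴾ t'))
-- The first clause splits both components of s before the move; splitting the move first
-- gets stuck unifying m + m' with suc _.
⟶-⊕ᴾ-inv (suc m , suc n) _ ⋆↦0  = inj₁ (_ , ⋆↦0 , refl)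
⟶-⊕ᴾ-inv (m , suc n)     _ ⋆2↦0 = inj₁ (_ , ⋆2↦0 , refl)
⟶-⊕ᴾ-inv (m , suc n)     _ ⋆2↦⋆ = inj₁ (_ , ⋆2↦⋆ , refl)
⟶-⊕ᴾ-inv (suc m , zero)  _ ⋆↦0  = inj₁ (_ , ⋆↦0 , refl)
⟶-⊕ᴾ-inv (zero , n)      _ ⋆↦0  = inj₂ (_ , ⋆↦0 , refl)
⟶-⊕ᴾ-inv (m , zero)      _ ⋆2↦0 = inj₂ (_ , ⋆2↦0 , refl)
⟶-⊕ᴾ-inv (m , zero) (m' , suc n') ⋆2↦⋆ = inj₂ (_ , ⋆2↦⋆ , cong (_, n') (sym (+-suc m m')))

-- even (suc n) comes first so that isPᴬ (m , 1) reduces to false.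
isPᴬ : Pos → Bool
isPᴬ (m , zero)  = not (even m)
isPᴬ (m , suc n) = even (suc n) ∧ even m

isPᴬ-nonterminal : ∀ {s} → isPᴬ s ≡ true → ∃[ s' ] s ⟶ s'
isPᴬ-nonterminal {zero , zero} ()
isPᴬ-nonterminal {suc m , n}   _ = _ , ⋆↦0
isPᴬ-nonterminal {zero , suc n} _ = _ , ⋆2↦0

isPᴬ-movesToN : ∀ {s s'} → isPᴬ s ≡ true → s ⟶ s' → isPᴬ s' ≡ false
isPᴬ-movesToN {suc m , zero} s-P ⋆↦0 with even m
... | true = refl
isPᴬ-movesToN {suc m , suc n} s-P ⋆↦0 with even n | even m
... | true | _ = refl
... | false | false = refl
isPᴬ-movesToN {m , suc zero} () ⋆2↦0
isPᴬ-movesToN {m , suc zero} () ⋆2↦⋆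
isPᴬ-movesToN {m , suc (suc n)} s-P ⋆2↦0 with even n
... | true = refl
isPᴬ-movesToN {m , suc (suc n)} s-P ⋆2↦⋆ with even n
... | true = refl

isPᴬ-terminal⊎movesToP : ∀ {s} → isPᴬ s ≡ false →
  Terminal s ⊎ ∃[ s' ] (s ⟶ s' × isPᴬ s' ≡ true)
isPᴬ-terminal⊎movesToP {zero , zero} _ = inj₁ λ ()
isPᴬ-terminal⊎movesToP {suc m , zero} _ with even m in em
... | false = inj₂ (_ , ⋆↦0 , cong not em)
isPᴬ-terminal⊎movesToP {m , suc zero} _ with even m in em
... | true  = inj₂ (_ , ⋆2↦⋆ , cong (not ∘ not) em)
... | false = inj₂ (_ , ⋆2↦0 , cong not em)
isPᴬ-terminal⊎movesToP {zero , suc (suc n)} _ with even n in en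
... | false = inj₂ (_ , ⋆2↦0 , cong (λ b → not b ∧ true) en)
isPᴬ-terminal⊎movesToP {suc m , suc (suc n)} _ with even n in en | even m in em
... | false | true  = inj₂ (_ , ⋆2↦⋆ , cong₂ (λ a b → not a ∧ not (not b)) en em)
... | false | false = inj₂ (_ , ⋆2↦0 , cong₂ (λ a b → not a ∧ not b) en em)
... | true  | true  = inj₂ (_ , ⋆↦0 , cong₂ (λ a b → not (not a) ∧ b) en em)

isPᴬ-labelling : IsMisereLabelling isPᴬ
isPᴬ-labelling = record
  { P⇒nonterminal       = isPᴬ-nonterminal
  ; P⇒movesToN          = isPᴬ-movesToN
  ; N⇒terminal⊎movesToP = isPᴬ-terminal⊎movesToP
  }

open Additive _⊕ᴾ_ ⟶-⊕ᴾʳ ⟶-⊕ᴾˡ ⟶-⊕ᴾ-inv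

𝟘∼ : 𝟘 ∼ (0 , 0)
𝟘∼ = bisim (λ ()) (λ ())

⋆∼ : ⋆ ∼ (1 , 0)
⋆∼ = bisim (λ _ → _ , ⋆↦0 , 𝟘∼) λ { ⋆↦0 → fzero , 𝟘∼ }

⋆2∼ : ⋆2 ∼ (0 , 1)
⋆2∼ = bisim (λ { fzero → _ , ⋆2↦0 , 𝟘∼ ; (fsuc _) → _ , ⋆2↦⋆ , ⋆∼ })
            (λ { ⋆2↦0 → fzero , 𝟘∼ ; ⋆2↦⋆ → fsuc fzero , ⋆∼ })

·⋆∼ : ∀ m → m · ⋆ ∼ (m , 0)
·⋆∼ zero    = 𝟘∼
·⋆∼ (suc m) = ∼-⊕ ⋆∼ (·⋆∼ m)

·⋆2∼ : ∀ n → n · ⋆2 ∼ (0 , n)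
·⋆2∼ zero    = 𝟘∼
·⋆2∼ (suc n) = ∼-⊕ ⋆2∼ (·⋆2∼ n)

elemA∼ : ∀ m n → elemA m n ∼ (m , n)
elemA∼ m n = subst (elemA m n ∼_) (cong (_, n) (+-identityʳ m)) (∼-⊕ (·⋆∼ m) (·⋆2∼ n))

isP-elemA-⊕ : ∀ m n a b → isP (elemA m n ⊕ elemA a b) ≡ isPᴬ (m + a , n + b)
isP-elemA-⊕ m n a b = isP-∼ isPᴬ-labelling (∼-⊕ (elemA∼ m n) (elemA∼ a b))

isPᴬ-cong-%2 : ∀ {m n m' n'} → 1 ≤ n → 1 ≤ n' → m % 2 ≡ m' % 2 → n % 2 ≡ n' % 2 →
  isPᴬ (m , n) ≡ isPᴬ (m' , n')
isPᴬ-cong-%2 {m} {n} {m'} {n'} (s≤s z≤n) (s≤s z≤n) m≡m' n≡n' =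
  cong₂ _∧_ (even-cong-%2 n n' n≡n') (even-cong-%2 m m' m≡m')

o⁻-cong : ∀ G H → isP G ≡ isP H → o⁻ G ≡ o⁻ H
o⁻-cong G H isP≡ rewrite isP≡ = refl

mainTheorem6 : (m n m' n' : ℕ) → 1 ≤ n → 1 ≤ n' →
    m % 2 ≡ m' % 2 → n % 2 ≡ n' % 2 →
    elemA m n ≡𝒜 elemA m' n'
mainTheorem6 m n m' n' 1≤n 1≤n' m≡m' n≡n' a b = o⁻-cong (elemA m n ⊕ X) (elemA m' n' ⊕ X) (begin
  isP (elemA m n ⊕ X)    ≡⟨ isP-elemA-⊕ m n a b ⟩
  isPᴬ (m + a , n + b)   ≡⟨ isPᴬ-cong-%2 (m≤n⇒m≤n+o b 1≤n) (m≤n⇒m≤n+o b 1≤n')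
                              (%2-cong-+ʳ m m' a m≡m') (%2-cong-+ʳ n n' b n≡n') ⟩
  isPᴬ (m' + a , n' + b) ≡⟨ isP-elemA-⊕ m' n' a b ⟨
  isP (elemA m' n' ⊕ X)  ∎)
  where
  X : Game
  X = elemA a b
  open ≡-Reasoning
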